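{- Let $S_0,S_1,S_2$ be non-negative integers and $S:\{0,1,2\}^*\to\mathbb{N}$ the semigroup homomorphism with $S(i)=S_i$. For $n\ge1$ let \[m(n)=\tfrac12\lfloor n\varphi\rfloor(S_0-2S_1+S_2)-\tfrac12 n(S_0-4S_1+S_2).\] If $|\mathbf f[1,n-1]|_0$ is odd, then $S(T(0\mathbf f[1,n-1]))=S(\overline T(0\mathbf f[1,n-1]))=m(n)+\tfrac12S_0-S_1+\tfrac12S_2$, $S(T(1\mathbf f[1,n-1]))=m(n)+\tfrac12S_0-\tfrac12S_2$, and $S(\overline T(1\mathbf f[1,n-1]))=m(n)-\tfrac12S_0+\tfrac12S_2$. If $|\mathbf f[1,n-1]|_0$ is even, then $S(T(0\mathbf f[1,n-1]))=m(n)+S_0-S_1$, $S(\overline T(0\mathbf f[1,n-1]))=m(n)-S_1+S_2$, and $S(T(1\mathbf f[1,n-1]))=S(\overline T(1\mathbf f[1,n-1]))=m(n)$.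
   Context: $\varphi=(1+\sqrt5)/2$, $\alpha=2-\varphi$, $\mathbf{f}=(\lfloor (n+1)\alpha\rfloor-\lfloor n\alpha\rfloor)_{n\ge1}$ (the Fibonacci word) and $\mathbf f[1,n-1]$ its prefix of length $n-1$ (empty if $n=1$). For a finite word over $\{0,1\}$, $T$ keeps each $1$ and replaces the 2nd, 4th, 6th, $\dots$ occurrences of $0$ by $2$; $\overline T$ keeps each $1$ and replaces the 1st, 3rd, 5th, $\dots$ occurrences of $0$ by $2$. A semigroup homomorphism satisfies $S(uv)=S(u)+S(v)$, so $S(w)=S_0|w|_0+S_1|w|_1+S_2|w|_2$. -}

module Defs where

open import Data.Nat as ℕ using (ℕ; zero; suc; _≤ᵇ_)
open import Data.Bool using (Bool; true; false; _∨_; _∧_; if_then_else_)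
open import Data.List using (List; []; _∷_; map)
open import Data.Integer as ℤ using (ℤ; +_)

range : ℕ → ℕ → List ℕ
range a zero = []
range a (suc len) = a ∷ range (suc a) len

countBy : {A : Set} → (A → Bool) → List A → ℕ
countBy p [] = 0
countBy p (x ∷ xs) = if p x then suc (countBy p xs) else countBy p xs

-- φ = (1+√5)/2.  For naturals n,k:  k ≤ nφ  ⇔  2k ≤ n + n√5
--   ⇔  2k ≤ n  ∨  (2k - n)² ≤ 5n²   (exact integer test)
leφ : ℕ → ℕ → Bool
leφ n k = ((2 ℕ.* k) ≤ᵇ n) ∨ (((2 ℕ.* k ℕ.∸ n) ℕ.* (2 ℕ.* k ℕ.∸ n)) ≤ᵇ (5 ℕ.* n ℕ.* n))

-- α = 2 - φ = (3-√5)/2.  For naturals n,k:  k ≤ nα  ⇔  n√5 ≤ 3n - 2k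
--   ⇔  2k ≤ 3n  ∧  5n² ≤ (3n - 2k)²   (exact integer test)
leα : ℕ → ℕ → Bool
leα n k = ((2 ℕ.* k) ≤ᵇ (3 ℕ.* n)) ∧ ((5 ℕ.* n ℕ.* n) ≤ᵇ ((3 ℕ.* n ℕ.∸ 2 ℕ.* k) ℕ.* (3 ℕ.* n ℕ.∸ 2 ℕ.* k)))

-- ⌊nφ⌋ = #{ k ≥ 1 : k ≤ nφ }, and all such k satisfy k ≤ 2n since nφ < 2n
floorφ : ℕ → ℕ
floorφ n = countBy (leφ n) (range 1 (2 ℕ.* n))

-- ⌊nα⌋ = #{ k ≥ 1 : k ≤ nα }, and all such k satisfy k ≤ n since nα < n
floorα : ℕ → ℕ
floorα n = countBy (leα n) (range 1 n)

-- Fibonacci word: f n = ⌊(n+1)α⌋ - ⌊nα⌋  (meaningful for n ≥ 1)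
fib : ℕ → ℕ
fib n = floorα (suc n) ℕ.∸ floorα n

fibPrefix : ℕ → List ℕ
fibPrefix n = map fib (range 1 (n ℕ.∸ 1))

count0 : List ℕ → ℕ
count0 = countBy (λ x → x ℕ.≡ᵇ 0)

-- T-transforms on words over {0,1} (letters as naturals 0,1,2).
-- The Bool flag records whether the next 0 to be read has EVEN index.
Tgo : Bool → List ℕ → List ℕ
Tgo b [] = []
Tgo b (zero ∷ w) = (if b then 2 else 0) ∷ Tgo (if b then false else true) w
Tgo b (suc x ∷ w) = suc x ∷ Tgo b w

-- T: 1st,3rd,... zeros kept; 2nd,4th,... zeros ↦ 2
T : List ℕ → List ℕ
T = Tgo false

-- T̄: 1st,3rd,... zeros ↦ 2; 2nd,4th,... kept
Tbar : List ℕ → List ℕ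
Tbar = Tgo true

Sletter : ℕ → ℕ → ℕ → ℕ → ℕ
Sletter S₀ S₁ S₂ zero = S₀
Sletter S₀ S₁ S₂ (suc zero) = S₁
Sletter S₀ S₁ S₂ (suc (suc _)) = S₂

S : ℕ → ℕ → ℕ → List ℕ → ℕ
S S₀ S₁ S₂ [] = 0
S S₀ S₁ S₂ (a ∷ w) = Sletter S₀ S₁ S₂ a ℕ.+ S S₀ S₁ S₂ w

twiceM : ℕ → ℕ → ℕ → ℕ → ℤ
twiceM S₀ S₁ S₂ n =
  (+ floorφ n) ℤ.* ((+ S₀) ℤ.- (+ 2) ℤ.* (+ S₁) ℤ.+ (+ S₂))
  ℤ.- (+ n) ℤ.* ((+ S₀) ℤ.- (+ 4) ℤ.* (+ S₁) ℤ.+ (+ S₂))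

module Submission where

open import Defs
open import Data.Nat using (ℕ; _≥_; _%_)
open import Data.List using (_∷_)
open import Data.Product using (_×_)
open import Relation.Binary.PropositionalEquality using (_≡_)

-- Write w = f[1,n−1], z = |w|₀ and o = |w|₁.
-- Words: T keeps ⌈z/2⌉ of the zeros of a binary word and turns ⌊z/2⌋ of them into 2
-- (T̄ the other way round), so S∘T and S∘T̄ depend only on z, o and the parity of z.
-- Numbers: f is the difference word of k ↦ ⌊kα⌋, whose steps are 0 or 1 since 0 < α < 1;
-- hence w is binary and, by telescoping, o = ⌊nα⌋ and z + o = n − 1.  Beatty
-- complementarity for α + φ = 2 (which needs √5 irrational) gives ⌊nα⌋ + ⌊nφ⌋ = 2n − 1,
-- so ⌊nφ⌋ = 1 + 2z + o and 2·m(n) = z(S₀ + S₂) + 2(1 + o)S₁.  In each of the eight cases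
-- the corollary is then a ring identity.

module Counting where

  open import Data.Bool using (Bool; true; false; not) renaming (T to Holds)
  open import Data.Empty using (⊥-elim)
  open import Data.List using (List; []; _∷_; _++_; map; length; downFrom)
  open import Data.Nat
  open import Data.Nat.Properties
  open import Function using (_∘_)
  open import Relation.Binary.PropositionalEquality
  open import Relation.Nullary using (¬_)

  private variable A B : Set

  countBy-++ : (p : A → Bool) (xs ys : List A) → countBy p (xs ++ ys) ≡ countBy p xs + countBy p ys
  countBy-++ p [] ys = refl
  countBy-++ p (x ∷ xs) ys with p x
  ... | true = cong suc (countBy-++ p xs ys)
  ... | false = countBy-++ p xs ys

  countBy-map : (p : B → Bool) (f : A → B) (xs : List A) → countBy p (map f xs) ≡ countBy (p ∘ f) xs
  countBy-map p f [] = refl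
  countBy-map p f (x ∷ xs) with p (f x)
  ... | true = cong suc (countBy-map p f xs)
  ... | false = countBy-map p f xs

  countBy-cong : {p q : A → Bool} → (∀ x → p x ≡ q x) → (xs : List A) → countBy p xs ≡ countBy q xs
  countBy-cong p≗q [] = refl
  countBy-cong {q = q} p≗q (x ∷ xs) rewrite p≗q x with q x
  ... | true = cong suc (countBy-cong p≗q xs)
  ... | false = countBy-cong p≗q xs

  countBy-not : (p : A → Bool) (xs : List A) → countBy (not ∘ p) xs + countBy p xs ≡ length xs
  countBy-not p [] = refl
  countBy-not p (x ∷ xs) with p x
  ... | true = trans (+-suc _ _) (cong suc (countBy-not p xs))
  ... | false = cong suc (countBy-not p xs)

  countBy-mono : {p q : A → Bool} → (∀ x → Holds (p x) → Holds (q x)) → (xs : List A) →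
    countBy p xs ≤ countBy q xs
  countBy-mono p⇒q [] = z≤n
  countBy-mono {p = p} {q} p⇒q (x ∷ xs) with p x | q x | p⇒q x
  ... | true | true | _ = s≤s (countBy-mono p⇒q xs)
  ... | true | false | h = ⊥-elim (h _)
  ... | false | true | _ = m≤n⇒m≤1+n (countBy-mono p⇒q xs)
  ... | false | false | _ = countBy-mono p⇒q xs

  countBy-∷-≤ : (p : A → Bool) (x : A) (xs : List A) → countBy p (x ∷ xs) ≤ suc (countBy p xs)
  countBy-∷-≤ p x xs with p x
  ... | true = ≤-refl
  ... | false = n≤1+n _

  countBy-∷-holds : (p : A → Bool) (x : A) (xs : List A) → Holds (p x) → countBy p (x ∷ xs) ≡ suc (countBy p xs)
  countBy-∷-holds p x xs px with p x
  ... | true = refl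

  range-length : ∀ a len → length (range a len) ≡ len
  range-length a zero = refl
  range-length a (suc len) = cong suc (range-length (suc a) len)

  range-++ : ∀ a m l → range a (m + l) ≡ range a m ++ range (a + m) l
  range-++ a zero l rewrite +-identityʳ a = refl
  range-++ a (suc m) l rewrite +-suc a m = cong (a ∷_) (range-++ (suc a) m l)

  range-suc : ∀ a len → range (suc a) len ≡ map suc (range a len)
  range-suc a zero = refl
  range-suc a (suc len) = cong (suc a ∷_) (range-suc (suc a) len)

  countBy-range-none : (p : ℕ → Bool) → ∀ a len → (∀ k → a ≤ k → ¬ Holds (p k)) → countBy p (range a len) ≡ 0
  countBy-range-none p a zero none = refl
  countBy-range-none p a (suc len) none with p a | none a ≤-refl
  ... | true | h = ⊥-elim (h _)
  ... | false | _ = countBy-range-none p (suc a) len (λ k a<k → none k (<⇒≤ a<k))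

  map-∸-range : ∀ a N → map ((a + N) ∸_) (range a (suc N)) ≡ downFrom (suc N)
  map-∸-range a zero rewrite +-identityʳ a | n∸n≡0 a = refl
  map-∸-range a (suc N) = cong₂ _∷_ (m+n∸m≡n a (suc N))
    (subst (λ M → map (M ∸_) (range (suc a) (suc N)) ≡ downFrom (suc N)) (sym (+-suc a N)) (map-∸-range (suc a) N))

  countBy-downFrom : (p : ℕ → Bool) → ∀ n → countBy p (downFrom n) ≡ countBy p (range 0 n)
  countBy-downFrom p zero = refl
  countBy-downFrom p (suc n) = begin
    countBy p (downFrom (suc n))                 ≡⟨ countBy-++ p (n ∷ []) (downFrom n) ⟩
    countBy p (n ∷ []) + countBy p (downFrom n)  ≡⟨ cong (countBy p (n ∷ []) +_) (countBy-downFrom p n) ⟩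
    countBy p (n ∷ []) + countBy p (range 0 n)   ≡⟨ +-comm (countBy p (n ∷ [])) _ ⟩
    countBy p (range 0 n) + countBy p (n ∷ [])   ≡⟨ countBy-++ p (range 0 n) (n ∷ []) ⟨
    countBy p (range 0 n ++ range n 1)           ≡⟨ cong (countBy p) (range-++ 0 n 1) ⟨
    countBy p (range 0 (n + 1))                  ≡⟨ cong (countBy p ∘ range 0) (+-comm n 1) ⟩
    countBy p (range 0 (suc n))                  ∎
    where open ≡-Reasoning

  countBy-reflect : (p : ℕ → Bool) → ∀ N → countBy (λ k → p (N ∸ k)) (range 0 (suc N)) ≡ countBy p (range 0 (suc N))
  countBy-reflect p N = begin
    countBy (λ k → p (N ∸ k)) (range 0 (suc N)) ≡⟨ countBy-map p (N ∸_) (range 0 (suc N)) ⟨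
    countBy p (map (N ∸_) (range 0 (suc N)))    ≡⟨ cong (countBy p) (map-∸-range 0 N) ⟩
    countBy p (downFrom (suc N))                ≡⟨ countBy-downFrom p (suc N) ⟩
    countBy p (range 0 (suc N))                 ∎
    where open ≡-Reasoning

module BinaryWords where

  open import Data.List using (List; _∷_; length)
  open import Data.List.Relation.Unary.All using (All; []; _∷_)
  open import Data.Nat
  open import Data.Nat.DivMod using (m≡m%n+[m/n]*n)
  open import Data.Nat.ListAction using (sum)
  open import Data.Nat.Properties
  open import Data.Nat.Tactic.RingSolver using (solve-∀)
  open import Data.Product using (_,_)
  open import Relation.Binary.PropositionalEquality

  Binary : List ℕ → Set
  Binary = All (_≤ 1)

  count1 : List ℕ → ℕ
  count1 = countBy (_≡ᵇ 1)

  binary-count1 : ∀ {w} → Binary w → count1 w ≡ sum w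
  binary-count1 [] = refl
  binary-count1 (z≤n ∷ bin) = binary-count1 bin
  binary-count1 (s≤s z≤n ∷ bin) = cong suc (binary-count1 bin)

  binary-count : ∀ {w} → Binary w → count0 w + count1 w ≡ length w
  binary-count [] = refl
  binary-count (z≤n ∷ bin) = cong suc (binary-count bin)
  binary-count {_ ∷ w} (s≤s z≤n ∷ bin) = trans (+-suc (count0 w) (count1 w)) (cong suc (binary-count bin))

  parity-split : ∀ z → z ≡ z % 2 + (z / 2 + z / 2)
  parity-split z = trans (m≡m%n+[m/n]*n z 2)
    (cong (z % 2 +_) (trans (*-comm (z / 2) 2) (cong (z / 2 +_) (+-identityʳ (z / 2)))))

  module _ (s₀ s₁ s₂ : ℕ) where

    tally : ℕ → ℕ → ℕ → ℕ
    tally O C D = O * s₁ + C * s₀ + D * s₂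

    S-Tgo : ∀ {w} → Binary w →
      S s₀ s₁ s₂ (T w) ≡ tally (count1 w) ⌈ count0 w /2⌉ ⌊ count0 w /2⌋
      × S s₀ s₁ s₂ (Tbar w) ≡ tally (count1 w) ⌊ count0 w /2⌋ ⌈ count0 w /2⌉
    S-Tgo [] = refl , refl
    S-Tgo {_ ∷ w} (z≤n ∷ bin) with S-Tgo bin
    ... | sT , sT̄ = trans (cong (s₀ +_) sT̄) (add-first s₀ (count1 w) s₁ ⌊ count0 w /2⌋ ⌈ count0 w /2⌉ s₂)
                  , trans (cong (s₂ +_) sT) (add-last s₀ (count1 w) s₁ ⌈ count0 w /2⌉ ⌊ count0 w /2⌋ s₂)
      where
      add-first : ∀ a O b C D c → a + (O * b + C * a + D * c) ≡ O * b + suc C * a + D * c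
      add-first = solve-∀
      add-last : ∀ a O b C D c → c + (O * b + C * a + D * c) ≡ O * b + C * a + suc D * c
      add-last = solve-∀
    S-Tgo {_ ∷ w} (s≤s z≤n ∷ bin) with S-Tgo bin
    ... | sT , sT̄ = trans (cong (s₁ +_) sT) (add-one s₀ (count1 w) s₁ ⌈ count0 w /2⌉ ⌊ count0 w /2⌋ s₂)
                  , trans (cong (s₁ +_) sT̄) (add-one s₀ (count1 w) s₁ ⌊ count0 w /2⌋ ⌈ count0 w /2⌉ s₂)
      where
      add-one : ∀ a O b C D c → b + (O * b + C * a + D * c) ≡ suc O * b + C * a + D * c
      add-one = solve-∀

    S-Tgo-even : ∀ {w} q → Binary w → count0 w ≡ q + q →
      S s₀ s₁ s₂ (T w) ≡ tally (count1 w) q q × S s₀ s₁ s₂ (Tbar w) ≡ tally (count1 w) q q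
    S-Tgo-even {w} q bin z≡2q with S-Tgo bin
    ... | sT , sT̄ = trans sT (cong₂ (tally (count1 w)) ⌈z/2⌉≡q ⌊z/2⌋≡q)
                  , trans sT̄ (cong₂ (tally (count1 w)) ⌊z/2⌋≡q ⌈z/2⌉≡q)
      where
      ⌊z/2⌋≡q : ⌊ count0 w /2⌋ ≡ q
      ⌊z/2⌋≡q = trans (cong ⌊_/2⌋ z≡2q) (sym (n≡⌊n+n/2⌋ q))
      ⌈z/2⌉≡q : ⌈ count0 w /2⌉ ≡ q
      ⌈z/2⌉≡q = trans (cong ⌈_/2⌉ z≡2q) (sym (n≡⌈n+n/2⌉ q))

    S-Tgo-odd : ∀ {w} q → Binary w → count0 w ≡ suc (q + q) →
      S s₀ s₁ s₂ (T w) ≡ tally (count1 w) (suc q) q × S s₀ s₁ s₂ (Tbar w) ≡ tally (count1 w) q (suc q)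
    S-Tgo-odd {w} q bin z≡2q+1 with S-Tgo bin
    ... | sT , sT̄ = trans sT (cong₂ (tally (count1 w)) ⌈z/2⌉≡q+1 ⌊z/2⌋≡q)
                  , trans sT̄ (cong₂ (tally (count1 w)) ⌊z/2⌋≡q ⌈z/2⌉≡q+1)
      where
      ⌊z/2⌋≡q : ⌊ count0 w /2⌋ ≡ q
      ⌊z/2⌋≡q = trans (cong ⌊_/2⌋ z≡2q+1) (sym (n≡⌈n+n/2⌉ q))
      ⌈z/2⌉≡q+1 : ⌈ count0 w /2⌉ ≡ suc q
      ⌈z/2⌉≡q+1 = trans (cong ⌈_/2⌉ z≡2q+1) (cong suc (sym (n≡⌊n+n/2⌋ q)))

module Sqrt5 where

  open import Data.Nat
  open import Data.Nat.Divisibility using (_∣_; divides)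
  open import Data.Nat.Induction using (<-rec)
  open import Data.Nat.Primality using (prime?; euclidsLemma)
  open import Data.Nat.Properties
  open import Data.Nat.Tactic.RingSolver using (solve-∀)
  open import Data.Product using (Σ; _,_)
  open import Data.Sum using (inj₁; inj₂)
  open import Relation.Binary.PropositionalEquality
  open import Relation.Nullary.Decidable using (from-yes)

  five-∣-square : ∀ x → 5 ∣ x * x → Σ ℕ λ a → x ≡ a * 5
  five-∣-square x 5∣x² with euclidsLemma x x (from-yes (prime? 5)) 5∣x²
  ... | inj₁ (divides a x≡a*5) = a , x≡a*5
  ... | inj₂ (divides a x≡a*5) = a , x≡a*5

  -- √5 is irrational: x² = 5n² forces n = 0.  By descent: x = 5a gives n² = 5a²,
  -- so n = 5b and a² = 5b² with b < n unless b = 0.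
  sqrt5-irrational : ∀ n x → x * x ≡ 5 * n * n → n ≡ 0
  sqrt5-irrational = <-rec _ descent
    where
    descent : ∀ n → (∀ {b} → b < n → ∀ a → a * a ≡ 5 * b * b → b ≡ 0) → ∀ x → x * x ≡ 5 * n * n → n ≡ 0
    descent n rec x x²≡5n² with five-∣-square x (divides (n * n) (trans x²≡5n² (reorder n)))
      where reorder : ∀ n → 5 * n * n ≡ n * n * 5
            reorder = solve-∀
    ... | a , refl with five-∣-square n (divides (a * a) n²≡5a²)
      where
      n²≡5a² : n * n ≡ a * a * 5
      n²≡5a² = *-cancelˡ-≡ (n * n) (a * a * 5) 5 (trans (sym (reorder n)) (trans (sym x²≡5n²) (reorder′ a)))
        where reorder : ∀ n → 5 * n * n ≡ 5 * (n * n)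
              reorder = solve-∀
              reorder′ : ∀ a → a * 5 * (a * 5) ≡ 5 * (a * a * 5)
              reorder′ = solve-∀
    ... | zero , refl = refl
    ... | suc b , refl = cong (_* 5) (rec (m<m*n (suc b) 5 (s≤s (s≤s z≤n))) a a²≡5b²)
      where
      a²≡5b² : a * a ≡ 5 * suc b * suc b
      a²≡5b² = *-cancelˡ-≡ (a * a) (5 * suc b * suc b) 25 (trans (reorder a) (trans x²≡5n² (reorder′ (suc b))))
        where reorder : ∀ a → 25 * (a * a) ≡ a * 5 * (a * 5)
              reorder = solve-∀
              reorder′ : ∀ b → 5 * (b * 5) * (b * 5) ≡ 25 * (5 * b * b)
              reorder′ = solve-∀

module Thresholds where

  open Sqrt5
  open import Data.Bool using (true; false; not) renaming (T to Holds)
  open import Data.Bool.Properties using (T-∧)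
  open import Data.Empty using (⊥-elim)
  open import Data.Nat
  open import Data.Nat.Properties
  open import Data.Nat.Tactic.RingSolver using (solve-∀)
  open import Data.Product using (_,_)
  open import Data.Sum using (inj₁; inj₂)
  open import Data.Unit using (tt)
  open import Function using (Equivalence)
  open import Relation.Binary.PropositionalEquality
  open import Relation.Nullary using (¬_)

  5n²≤[3n]² : ∀ n → 5 * n * n ≤ (3 * n) * (3 * n)
  5n²≤[3n]² n = ≤-trans (*-monoˡ-≤ n (*-monoˡ-≤ n (m≤m+n 5 4))) (≤-reflexive (e n))
    where e : ∀ n → 9 * n * n ≡ 3 * n * (3 * n)
          e = solve-∀

  -- Exact squares: if 5n² ≤ x² then 5(n+1)² ≤ (x+3)², because x > 2n.
  square-up : ∀ n x → 5 * n * n ≤ x * x → 5 * suc n * suc n ≤ (3 + x) * (3 + x)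
  square-up n x 5n²≤x² = begin
    5 * suc n * suc n              ≡⟨ expand₁ n ⟩
    5 * n * n + (5 * (2 * n) + 5)  ≤⟨ +-mono-≤ 5n²≤x² (+-mono-≤ (*-mono-≤ (n≤1+n 5) 2n≤x) (m≤m+n 5 4)) ⟩
    x * x + (6 * x + 9)            ≡⟨ expand₂ x ⟨
    (3 + x) * (3 + x)              ∎
    where
    open ≤-Reasoning
    expand₁ : ∀ n → 5 * suc n * suc n ≡ 5 * n * n + (5 * (2 * n) + 5)
    expand₁ = solve-∀
    expand₂ : ∀ x → (3 + x) * (3 + x) ≡ x * x + (6 * x + 9)
    expand₂ = solve-∀
    4n²≤5n² : ∀ n → (2 * n) * (2 * n) ≤ 5 * n * n
    4n²≤5n² n = ≤-trans (≤-reflexive (e n)) (*-monoˡ-≤ n (*-monoˡ-≤ n (n≤1+n 4)))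
      where e : ∀ n → 2 * n * (2 * n) ≡ 4 * n * n
            e = solve-∀
    2n≤x : 2 * n ≤ x
    2n≤x = ≮⇒≥ λ x<2n → <⇒≱ (*-mono-< x<2n x<2n) (≤-trans (4n²≤5n² n) 5n²≤x²)

  -- Exact squares: if x² < 5n² then (x+1)² < 5(n+1)², because x < 3n.
  square-down : ∀ n x → x * x < 5 * n * n → (1 + x) * (1 + x) < 5 * suc n * suc n
  square-down n x x²<5n² = begin-strict
    (1 + x) * (1 + x)                           ≡⟨ expand₁ x ⟩
    x * x + (2 * x + 1)                         <⟨ +-mono-<-≤ x²<5n² (+-monoˡ-≤ 1 (*-monoʳ-≤ 2 (<⇒≤ x<3n))) ⟩
    5 * n * n + (2 * (3 * n) + 1)               ≤⟨ m≤m+n _ (4 * n + 4) ⟩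
    5 * n * n + (2 * (3 * n) + 1) + (4 * n + 4) ≡⟨ expand₂ n ⟨
    5 * suc n * suc n                           ∎
    where
    open ≤-Reasoning
    expand₁ : ∀ x → (1 + x) * (1 + x) ≡ x * x + (2 * x + 1)
    expand₁ = solve-∀
    expand₂ : ∀ n → 5 * suc n * suc n ≡ 5 * n * n + (2 * (3 * n) + 1) + (4 * n + 4)
    expand₂ = solve-∀
    x<3n : x < 3 * n
    x<3n = ≰⇒> λ 3n≤x → <⇒≱ x²<5n² (≤-trans (5n²≤[3n]² n) (*-mono-≤ 3n≤x 3n≤x))

  leα-holds : ∀ n k → Holds (leα n k) → 2 * k ≤ 3 * n × 5 * n * n ≤ (3 * n ∸ 2 * k) * (3 * n ∸ 2 * k)
  leα-holds n k h with Equivalence.to T-∧ h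
  ... | h₁ , h₂ = ≤ᵇ⇒≤ _ _ h₁ , ≤ᵇ⇒≤ _ _ h₂

  leα-intro : ∀ n k → 2 * k ≤ 3 * n → 5 * n * n ≤ (3 * n ∸ 2 * k) * (3 * n ∸ 2 * k) → Holds (leα n k)
  leα-intro n k h₁ h₂ = Equivalence.from T-∧ (≤⇒≤ᵇ h₁ , ≤⇒≤ᵇ h₂)

  leα-origin : ∀ n → Holds (leα n 0)
  leα-origin n = leα-intro n 0 z≤n (5n²≤[3n]² n)

  leα-large : ∀ {n k} → n < k → ¬ Holds (leα n k)
  leα-large {n} {k} n<k h with leα-holds n k h
  ... | 2k≤3n , 5n²≤x² = <⇒≱ (<-≤-trans (*-mono-< x<n x<n) (*-monoˡ-≤ n (m≤n*m n 5))) 5n²≤x²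
    where
    open ≤-Reasoning
    x = 3 * n ∸ 2 * k
    x<n : x < n
    x<n = +-cancelʳ-< (2 * n) x n (begin-strict
      x + 2 * n  <⟨ +-monoʳ-< x (*-monoʳ-< 2 n<k) ⟩
      x + 2 * k  ≡⟨ m∸n+n≡m 2k≤3n ⟩
      3 * n      ≡⟨ e n ⟩
      n + 2 * n  ∎)
      where e : ∀ n → 3 * n ≡ n + 2 * n
            e = solve-∀

  -- k ≤ nα implies k ≤ (n+1)α, since α > 0.
  leα-mono : ∀ {n k} → Holds (leα n k) → Holds (leα (suc n) k)
  leα-mono {n} {k} h with leα-holds n k h
  ... | 2k≤3n , 5n²≤x² = leα-intro (suc n) k (≤-trans 2k≤3n (*-monoʳ-≤ 3 (n≤1+n n)))
    (subst (λ y → 5 * suc n * suc n ≤ y * y) (sym x′≡3+x) (square-up n (3 * n ∸ 2 * k) 5n²≤x²))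
    where
    x′≡3+x : 3 * suc n ∸ 2 * k ≡ 3 + (3 * n ∸ 2 * k)
    x′≡3+x = trans (cong (_∸ 2 * k) (*-suc 3 n)) (+-∸-assoc 3 2k≤3n)

  -- k+1 ≤ (n+1)α implies k ≤ nα, since α < 1.
  leα-shift : ∀ {n k} → Holds (leα (suc n) (suc k)) → Holds (leα n k)
  leα-shift {n} {k} h with leα-holds (suc n) (suc k) h
  ... | _ , 5n′²≤x′² = leα-intro n k 2k≤3n
    (≮⇒≥ λ x²<5n² → <⇒≱ (square-down n (3 * n ∸ 2 * k) x²<5n²) (subst (λ y → 5 * suc n * suc n ≤ y * y) x′≡1+x 5n′²≤x′²))
    where
    x′≡ : 3 * suc n ∸ 2 * suc k ≡ suc (3 * n) ∸ 2 * k
    x′≡ = trans (cong₂ _∸_ (e₁ n) (e₂ k)) ([m+n]∸[m+o]≡n∸o 2 (suc (3 * n)) (2 * k))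
      where e₁ : ∀ n → 3 * suc n ≡ 2 + suc (3 * n)
            e₁ = solve-∀
            e₂ : ∀ k → 2 * suc k ≡ 2 + 2 * k
            e₂ = solve-∀
    x′≢0 : suc (3 * n) ∸ 2 * k ≢ 0
    x′≢0 x′≡0 = <⇒≱ (s≤s z≤n) (subst (λ y → 5 * suc n * suc n ≤ y * y) (trans x′≡ x′≡0) 5n′²≤x′²)
    2k≤3n : 2 * k ≤ 3 * n
    2k≤3n = s≤s⁻¹ (m∸n≢0⇒n<m x′≢0)
    x′≡1+x : 3 * suc n ∸ 2 * suc k ≡ 1 + (3 * n ∸ 2 * k)
    x′≡1+x = trans x′≡ (+-∸-assoc 1 2k≤3n)

  leα-square : ∀ m k → leα (suc m) k ≡ (5 * suc m * suc m ≤ᵇ (3 * suc m ∸ 2 * k) * (3 * suc m ∸ 2 * k))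
  leα-square m k with 2 * k ≤ᵇ 3 * suc m in eq
  ... | true = refl
  ... | false = sym (cong (λ x → 5 * suc m * suc m ≤ᵇ x * x) (m≤n⇒m∸n≡0 {3 * suc m} {2 * k} 3n≤2k))
    where 3n≤2k = <⇒≤ (≰⇒> λ 2k≤3n → subst Holds eq (≤⇒≤ᵇ 2k≤3n))

  leφ-square : ∀ n j → leφ n j ≡ ((2 * j ∸ n) * (2 * j ∸ n) ≤ᵇ 5 * n * n)
  leφ-square n j with 2 * j ≤ᵇ n in eq
  ... | false = refl
  ... | true = sym (cong (λ y → y * y ≤ᵇ 5 * n * n) (m≤n⇒m∸n≡0 (≤ᵇ⇒≤ (2 * j) n (subst Holds (sym eq) tt))))

  not-≤ᵇ : ∀ a b → a ≢ b → not (a ≤ᵇ b) ≡ (b ≤ᵇ a)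
  not-≤ᵇ a b a≢b with a ≤ᵇ b in ab | b ≤ᵇ a in ba
  ... | true | true =
    ⊥-elim (a≢b (≤-antisym (≤ᵇ⇒≤ a b (subst Holds (sym ab) tt)) (≤ᵇ⇒≤ b a (subst Holds (sym ba) tt))))
  ... | true | false = refl
  ... | false | true = refl
  ... | false | false with ≤-total a b
  ...   | inj₁ a≤b = ⊥-elim (subst Holds ab (≤⇒≤ᵇ a≤b))
  ...   | inj₂ b≤a = ⊥-elim (subst Holds ba (≤⇒≤ᵇ b≤a))

  reflect-arith : ∀ n k → 2 * (2 * n ∸ k) ∸ n ≡ 3 * n ∸ 2 * k
  reflect-arith n k = begin
    2 * (2 * n ∸ k) ∸ n         ≡⟨ cong (_∸ n) (*-distribˡ-∸ 2 (2 * n) k) ⟩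
    (2 * (2 * n) ∸ 2 * k) ∸ n   ≡⟨ ∸-+-assoc (2 * (2 * n)) (2 * k) n ⟩
    2 * (2 * n) ∸ (2 * k + n)   ≡⟨ cong₂ _∸_ (e n) (+-comm (2 * k) n) ⟩
    (n + 3 * n) ∸ (n + 2 * k)   ≡⟨ [m+n]∸[m+o]≡n∸o n (3 * n) (2 * k) ⟩
    3 * n ∸ 2 * k               ∎
    where
    open ≡-Reasoning
    e : ∀ n → 2 * (2 * n) ≡ n + 3 * n
    e = solve-∀

  -- α + φ = 2 with φ irrational: for n ≥ 1, k ≤ nα exactly when 2n − k ≤ nφ fails.
  leα-complement : ∀ m k → leα (suc m) k ≡ not (leφ (suc m) (2 * suc m ∸ k))
  leα-complement m k rewrite leα-square m k | leφ-square (suc m) (2 * suc m ∸ k) | reflect-arith (suc m) k =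
    sym (not-≤ᵇ (x * x) (5 * suc m * suc m) (λ x²≡5n² → 0≢1+n (sym (sqrt5-irrational (suc m) x x²≡5n²))))
    where x = 3 * suc m ∸ 2 * k

module Beatty where

  open Counting
  open Thresholds
  open import Data.Bool using (Bool; not)
  open import Data.List using (_∷_; _++_; map; length)
  open import Data.Nat
  open import Data.Nat.Properties
  open import Function using (_∘_)
  open import Relation.Binary.PropositionalEquality

  floorα-mono : ∀ n → floorα n ≤ floorα (suc n)
  floorα-mono n = begin
    countBy (leα n) (range 1 n)                      ≤⟨ countBy-mono (λ k → leα-mono {n} {k}) (range 1 n) ⟩
    countBy (leα (suc n)) (range 1 n)                ≤⟨ m≤m+n _ _ ⟩
    countBy (leα (suc n)) (range 1 n) + countBy (leα (suc n)) (range (1 + n) 1)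
                                                     ≡⟨ countBy-++ (leα (suc n)) (range 1 n) (range (1 + n) 1) ⟨
    countBy (leα (suc n)) (range 1 n ++ range (1 + n) 1)
                                                     ≡⟨ cong (countBy (leα (suc n))) (range-++ 1 n 1) ⟨
    countBy (leα (suc n)) (range 1 (n + 1))          ≡⟨ cong (countBy (leα (suc n)) ∘ range 1) (+-comm n 1) ⟩
    countBy (leα (suc n)) (range 1 (suc n))          ∎
    where open ≤-Reasoning

  floorα-step : ∀ n → floorα (suc n) ≤ suc (floorα n)
  floorα-step n = begin
    countBy (leα (suc n)) (1 ∷ range 2 n)            ≤⟨ countBy-∷-≤ (leα (suc n)) 1 (range 2 n) ⟩
    suc (countBy (leα (suc n)) (range 2 n))          ≡⟨ cong (suc ∘ countBy (leα (suc n))) (range-suc 1 n) ⟩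
    suc (countBy (leα (suc n)) (map suc (range 1 n))) ≡⟨ cong suc (countBy-map (leα (suc n)) suc (range 1 n)) ⟩
    suc (countBy (leα (suc n) ∘ suc) (range 1 n))    ≤⟨ s≤s (countBy-mono (λ k → leα-shift {n} {k}) (range 1 n)) ⟩
    suc (countBy (leα n) (range 1 n))                ∎
    where open ≤-Reasoning

  -- Beatty complementarity for α + φ = 2:  ⌊nα⌋ + ⌊nφ⌋ = 2n − 1 for n ≥ 1.
  -- Both sides count the interval [0, 2n], which the reflection k ↦ 2n − k splits
  -- into the points below nα and the reflections of the points below nφ.
  floorα+floorφ : ∀ m → suc (floorα (suc m) + floorφ (suc m)) ≡ 2 * suc m
  floorα+floorφ m = suc-injective (begin
    suc (suc (floorα n + floorφ n))                 ≡⟨ cong suc (+-suc (floorα n) (floorφ n)) ⟨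
    suc (floorα n) + suc (floorφ n)                 ≡⟨ cong₂ _+_ countα (countBy-reflect (leφ n) N) ⟨
    countBy (leα n) R + countBy reflected R          ≡⟨ cong (_+ countBy reflected R) (countBy-cong (leα-complement m) R) ⟩
    countBy (not ∘ reflected) R + countBy reflected R ≡⟨ countBy-not reflected R ⟩
    length R                                         ≡⟨ range-length 0 (suc N) ⟩
    suc N                                            ∎)
    where
    open ≡-Reasoning
    n = suc m
    N = 2 * n
    R = range 0 (suc N)
    reflected : ℕ → Bool
    reflected k = leφ n (N ∸ k)
    countα : countBy (leα n) R ≡ suc (floorα n)
    countα = begin
      countBy (leα n) (0 ∷ range 1 N)               ≡⟨ countBy-∷-holds (leα n) 0 (range 1 N) (leα-origin n) ⟩
      suc (countBy (leα n) (range 1 N))             ≡⟨ cong (suc ∘ countBy (leα n) ∘ range 1) (cong (n +_) (+-identityʳ n)) ⟩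
      suc (countBy (leα n) (range 1 (n + n)))       ≡⟨ cong (suc ∘ countBy (leα n)) (range-++ 1 n n) ⟩
      suc (countBy (leα n) (range 1 n ++ range (1 + n) n)) ≡⟨ cong suc (countBy-++ (leα n) (range 1 n) (range (1 + n) n)) ⟩
      suc (floorα n + countBy (leα n) (range (1 + n) n))
                              ≡⟨ cong (λ c → suc (floorα n + c)) (countBy-range-none (leα n) (1 + n) n (λ k → leα-large)) ⟩
      suc (floorα n + 0)                            ≡⟨ cong suc (+-identityʳ (floorα n)) ⟩
      suc (floorα n)                                ∎

module FibonacciPrefix where

  open Counting
  open BinaryWords
  open Beatty
  open import Data.List using (_∷_; map)
  open import Data.List.Properties using (length-map)
  open import Data.List.Relation.Unary.All using ([]; _∷_)
  open import Data.Nat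
  open import Data.Nat.ListAction using (sum)
  open import Data.Nat.Properties
  open import Data.Nat.Tactic.RingSolver using (solve-∀)
  open import Relation.Binary.PropositionalEquality

  Δ : (ℕ → ℕ) → ℕ → ℕ
  Δ g k = g (suc k) ∸ g k

  Δ-binary : (g : ℕ → ℕ) → (∀ k → g (suc k) ≤ suc (g k)) → ∀ a N → Binary (map (Δ g) (range a N))
  Δ-binary g step a zero = []
  Δ-binary g step a (suc N) =
    ≤-trans (∸-monoˡ-≤ (g a) (step a)) (≤-reflexive (m+n∸n≡m 1 (g a))) ∷ Δ-binary g step (suc a) N

  telescope : (g : ℕ → ℕ) → (∀ k → g k ≤ g (suc k)) → ∀ a N → sum (map (Δ g) (range a N)) + g a ≡ g (a + N)
  telescope g mono a zero = cong g (sym (+-identityʳ a))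
  telescope g mono a (suc N) = begin
    (Δ g a + rest) + g a   ≡⟨ cong (_+ g a) (+-comm (Δ g a) rest) ⟩
    (rest + Δ g a) + g a   ≡⟨ +-assoc rest (Δ g a) (g a) ⟩
    rest + (Δ g a + g a)   ≡⟨ cong (rest +_) (m∸n+n≡m (mono a)) ⟩
    rest + g (suc a)       ≡⟨ telescope g mono (suc a) N ⟩
    g (suc a + N)          ≡⟨ cong g (+-suc a N) ⟨
    g (a + suc N)          ∎
    where
    open ≡-Reasoning
    rest = sum (map (Δ g) (range (suc a) N))

  -- The Fibonacci word is the difference word of ⌊nα⌋, so its prefixes are binary, ...
  fibPrefix-binary : ∀ m → Binary (fibPrefix (suc m))
  fibPrefix-binary = Δ-binary floorα floorα-step 1

  fibPrefix-letters : ∀ m → count0 (fibPrefix (suc m)) + count1 (fibPrefix (suc m)) ≡ m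
  fibPrefix-letters m = trans (binary-count (fibPrefix-binary m)) (trans (length-map fib (range 1 m)) (range-length 1 m))

  -- ... and contain ⌊nα⌋ − ⌊α⌋ = ⌊nα⌋ letters 1.
  fibPrefix-ones : ∀ m → count1 (fibPrefix (suc m)) ≡ floorα (suc m)
  fibPrefix-ones m = trans (binary-count1 (fibPrefix-binary m)) (trans (sym (+-identityʳ _)) (telescope floorα floorα-mono 1 m))

  -- Hence ⌊nφ⌋ = 2n − 1 − |f[1,n−1]|₁ = 1 + 2|f[1,n−1]|₀ + |f[1,n−1]|₁.
  floorφ-prefix : ∀ m → floorφ (suc m) ≡ suc (count0 (fibPrefix (suc m)) + count0 (fibPrefix (suc m)) + count1 (fibPrefix (suc m)))
  floorφ-prefix m = +-cancelˡ-≡ o (floorφ (suc m)) (suc (z + z + o)) (suc-injective (begin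
    suc (o + floorφ (suc m))             ≡⟨ cong (λ a → suc (a + floorφ (suc m))) (fibPrefix-ones m) ⟩
    suc (floorα (suc m) + floorφ (suc m)) ≡⟨ floorα+floorφ m ⟩
    2 * suc m                            ≡⟨ cong (λ l → 2 * suc l) (fibPrefix-letters m) ⟨
    2 * suc (z + o)                      ≡⟨ e z o ⟩
    suc (o + suc (z + z + o))            ∎))
    where
    open ≡-Reasoning
    z = count0 (fibPrefix (suc m))
    o = count1 (fibPrefix (suc m))
    e : ∀ z o → 2 * suc (z + o) ≡ suc (o + suc (z + z + o))
    e = solve-∀

open BinaryWords
open FibonacciPrefix
open import Data.Integer using (ℤ; +_; _+_; _-_; _*_)
open import Data.Integer.Properties using (pos-*)
open import Data.Integer.Tactic.RingSolver using (solve-∀)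
open import Data.List.Relation.Unary.All using (_∷_)
open import Data.Nat as ℕ using (suc; s≤s; z≤n; _/_)
open import Data.Nat.Properties using (+-suc)
open import Data.Product using (_,_; proj₁; proj₂)
open import Relation.Binary.PropositionalEquality using (sym; trans; cong; cong₂)

module _ (s₀ s₁ s₂ : ℕ) where

  -- 2·m(n) written through the letter counts z = |f[1,n−1]|₀, o = |f[1,n−1]|₁.
  doubledM : ℕ → ℕ → ℤ
  doubledM z o = (+ z) * (+ s₀ + + s₂) + (+ 2) * (+ suc o) * (+ s₁)

  twiceM-counts : ∀ n z o → floorφ n ≡ suc (z ℕ.+ z ℕ.+ o) → n ≡ suc (z ℕ.+ o) → twiceM s₀ s₁ s₂ n ≡ doubledM z o
  twiceM-counts n z o F≡ n≡ = trans
    (cong₂ (λ F N → (+ F) * (+ s₀ - (+ 2) * (+ s₁) + + s₂) - (+ N) * (+ s₀ - (+ 4) * (+ s₁) + + s₂)) F≡ n≡)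
    (collect (+ z) (+ o) (+ s₀) (+ s₁) (+ s₂))
    where
    collect : ∀ z o a b c → (+ 1 + z + z + o) * (a - (+ 2) * b + c) - (+ 1 + z + o) * (a - (+ 4) * b + c)
                          ≡ z * (a + c) + (+ 2) * (+ 1 + o) * b
    collect = solve-∀

  tally-ℤ : ∀ O C D → + tally s₀ s₁ s₂ O C D ≡ (+ O) * (+ s₁) + (+ C) * (+ s₀) + (+ D) * (+ s₂)
  tally-ℤ O C D = cong₂ _+_ (cong₂ _+_ (pos-* O s₁) (pos-* C s₀)) (pos-* D s₂)

  conclude : ∀ {X t d} O C D (E : ℤ → ℤ) → X ≡ tally s₀ s₁ s₂ O C D → t ≡ d →
    (+ 2) * ((+ O) * (+ s₁) + (+ C) * (+ s₀) + (+ D) * (+ s₂)) ≡ E d →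
    (+ 2) * (+ X) ≡ E t
  conclude O C D E X≡ t≡ identity =
    trans (cong ((+ 2) *_) (trans (cong +_ X≡) (tally-ℤ O C D))) (trans identity (cong E (sym t≡)))

  odd-case : ∀ {w} q t → Binary w → count0 w ≡ suc (q ℕ.+ q) → t ≡ doubledM (count0 w) (count1 w) →
      ((+ 2) * (+ S s₀ s₁ s₂ (T (0 ∷ w))) ≡ t + (+ s₀) - (+ 2) * (+ s₁) + (+ s₂))
    × ((+ 2) * (+ S s₀ s₁ s₂ (Tbar (0 ∷ w))) ≡ t + (+ s₀) - (+ 2) * (+ s₁) + (+ s₂))
    × ((+ 2) * (+ S s₀ s₁ s₂ (T (1 ∷ w))) ≡ t + (+ s₀) - (+ s₂))
    × ((+ 2) * (+ S s₀ s₁ s₂ (Tbar (1 ∷ w))) ≡ t - (+ s₀) + (+ s₂))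
  odd-case {w} q t bin z≡ t≡ =
      conclude o (suc q) (suc q) (λ t → t + (+ s₀) - (+ 2) * (+ s₁) + (+ s₂)) (proj₁ on-0w) t≡q
        (identity-0w (+ q) (+ o) (+ s₀) (+ s₁) (+ s₂))
    , conclude o (suc q) (suc q) (λ t → t + (+ s₀) - (+ 2) * (+ s₁) + (+ s₂)) (proj₂ on-0w) t≡q
        (identity-0w (+ q) (+ o) (+ s₀) (+ s₁) (+ s₂))
    , conclude (suc o) (suc q) q (λ t → t + (+ s₀) - (+ s₂)) (proj₁ on-1w) t≡q
        (identity-T1w (+ q) (+ o) (+ s₀) (+ s₁) (+ s₂))
    , conclude (suc o) q (suc q) (λ t → t - (+ s₀) + (+ s₂)) (proj₂ on-1w) t≡q
        (identity-T̄1w (+ q) (+ o) (+ s₀) (+ s₁) (+ s₂))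
    where
    o = count1 w
    t≡q : t ≡ doubledM (suc (q ℕ.+ q)) o
    t≡q = trans t≡ (cong (λ z → doubledM z o) z≡)
    -- 0w has 2(q+1) zeros, 1w has 2q+1 zeros.
    on-0w = S-Tgo-even s₀ s₁ s₂ (suc q) (z≤n ∷ bin) (cong suc (trans z≡ (sym (+-suc q q))))
    on-1w = S-Tgo-odd s₀ s₁ s₂ q (s≤s z≤n ∷ bin) z≡
    identity-0w : ∀ q o a b c → (+ 2) * (o * b + (+ 1 + q) * a + (+ 1 + q) * c)
                              ≡ (+ 1 + q + q) * (a + c) + (+ 2) * (+ 1 + o) * b + a - (+ 2) * b + c
    identity-0w = solve-∀
    identity-T1w : ∀ q o a b c → (+ 2) * ((+ 1 + o) * b + (+ 1 + q) * a + q * c)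
                               ≡ (+ 1 + q + q) * (a + c) + (+ 2) * (+ 1 + o) * b + a - c
    identity-T1w = solve-∀
    identity-T̄1w : ∀ q o a b c → (+ 2) * ((+ 1 + o) * b + q * a + (+ 1 + q) * c)
                               ≡ (+ 1 + q + q) * (a + c) + (+ 2) * (+ 1 + o) * b - a + c
    identity-T̄1w = solve-∀

  even-case : ∀ {w} q t → Binary w → count0 w ≡ q ℕ.+ q → t ≡ doubledM (count0 w) (count1 w) →
      ((+ 2) * (+ S s₀ s₁ s₂ (T (0 ∷ w))) ≡ t + (+ 2) * (+ s₀) - (+ 2) * (+ s₁))
    × ((+ 2) * (+ S s₀ s₁ s₂ (Tbar (0 ∷ w))) ≡ t - (+ 2) * (+ s₁) + (+ 2) * (+ s₂))
    × ((+ 2) * (+ S s₀ s₁ s₂ (T (1 ∷ w))) ≡ t)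
    × ((+ 2) * (+ S s₀ s₁ s₂ (Tbar (1 ∷ w))) ≡ t)
  even-case {w} q t bin z≡ t≡ =
      conclude o (suc q) q (λ t → t + (+ 2) * (+ s₀) - (+ 2) * (+ s₁)) (proj₁ on-0w) t≡q
        (identity-T0w (+ q) (+ o) (+ s₀) (+ s₁) (+ s₂))
    , conclude o q (suc q) (λ t → t - (+ 2) * (+ s₁) + (+ 2) * (+ s₂)) (proj₂ on-0w) t≡q
        (identity-T̄0w (+ q) (+ o) (+ s₀) (+ s₁) (+ s₂))
    , conclude (suc o) q q (λ t → t) (proj₁ on-1w) t≡q (identity-1w (+ q) (+ o) (+ s₀) (+ s₁) (+ s₂))
    , conclude (suc o) q q (λ t → t) (proj₂ on-1w) t≡q (identity-1w (+ q) (+ o) (+ s₀) (+ s₁) (+ s₂))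
    where
    o = count1 w
    t≡q : t ≡ doubledM (q ℕ.+ q) o
    t≡q = trans t≡ (cong (λ z → doubledM z o) z≡)
    -- 0w has 2q+1 zeros, 1w has 2q zeros.
    on-0w = S-Tgo-odd s₀ s₁ s₂ q (z≤n ∷ bin) (cong suc z≡)
    on-1w = S-Tgo-even s₀ s₁ s₂ q (s≤s z≤n ∷ bin) z≡
    identity-T0w : ∀ q o a b c → (+ 2) * (o * b + (+ 1 + q) * a + q * c)
                               ≡ (q + q) * (a + c) + (+ 2) * (+ 1 + o) * b + (+ 2) * a - (+ 2) * b
    identity-T0w = solve-∀
    identity-T̄0w : ∀ q o a b c → (+ 2) * (o * b + q * a + (+ 1 + q) * c)
                               ≡ (q + q) * (a + c) + (+ 2) * (+ 1 + o) * b - (+ 2) * b + (+ 2) * c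
    identity-T̄0w = solve-∀
    identity-1w : ∀ q o a b c → (+ 2) * ((+ 1 + o) * b + q * a + q * c)
                              ≡ (q + q) * (a + c) + (+ 2) * (+ 1 + o) * b
    identity-1w = solve-∀

corollary16 : (S₀ S₁ S₂ n : ℕ) → n ≥ 1 →
    (count0 (fibPrefix n) % 2 ≡ 1 →
        ((+ 2) * (+ S S₀ S₁ S₂ (T (0 ∷ fibPrefix n)))
           ≡ twiceM S₀ S₁ S₂ n + (+ S₀) - (+ 2) * (+ S₁) + (+ S₂))
      × ((+ 2) * (+ S S₀ S₁ S₂ (Tbar (0 ∷ fibPrefix n)))
           ≡ twiceM S₀ S₁ S₂ n + (+ S₀) - (+ 2) * (+ S₁) + (+ S₂))
      × ((+ 2) * (+ S S₀ S₁ S₂ (T (1 ∷ fibPrefix n)))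
           ≡ twiceM S₀ S₁ S₂ n + (+ S₀) - (+ S₂))
      × ((+ 2) * (+ S S₀ S₁ S₂ (Tbar (1 ∷ fibPrefix n)))
           ≡ twiceM S₀ S₁ S₂ n - (+ S₀) + (+ S₂)))
    ×
    (count0 (fibPrefix n) % 2 ≡ 0 →
        ((+ 2) * (+ S S₀ S₁ S₂ (T (0 ∷ fibPrefix n)))
           ≡ twiceM S₀ S₁ S₂ n + (+ 2) * (+ S₀) - (+ 2) * (+ S₁))
      × ((+ 2) * (+ S S₀ S₁ S₂ (Tbar (0 ∷ fibPrefix n)))
           ≡ twiceM S₀ S₁ S₂ n - (+ 2) * (+ S₁) + (+ 2) * (+ S₂))
      × ((+ 2) * (+ S S₀ S₁ S₂ (T (1 ∷ fibPrefix n)))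
           ≡ twiceM S₀ S₁ S₂ n)
      × ((+ 2) * (+ S S₀ S₁ S₂ (Tbar (1 ∷ fibPrefix n)))
           ≡ twiceM S₀ S₁ S₂ n))
corollary16 S₀ S₁ S₂ (suc m) (s≤s z≤n) =
    (λ odd  → odd-case  S₀ S₁ S₂ q t bin (trans (parity-split z) (cong (ℕ._+ (q ℕ.+ q)) odd)) t≡)
  , (λ even → even-case S₀ S₁ S₂ q t bin (trans (parity-split z) (cong (ℕ._+ (q ℕ.+ q)) even)) t≡)
  where
  z = count0 (fibPrefix (suc m))
  o = count1 (fibPrefix (suc m))
  q = z / 2
  t = twiceM S₀ S₁ S₂ (suc m)
  bin = fibPrefix-binary m
  t≡ : t ≡ doubledM S₀ S₁ S₂ z o
  t≡ = twiceM-counts S₀ S₁ S₂ (suc m) z o (floorφ-prefix m) (cong suc (sym (fibPrefix-letters m)))
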